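{- Let $\mathcal{F}$ be a finite signature, $E$ a finite set of permutation equations over $\mathcal{F}$, and $B$ a set of $B$-rules (possibly empty) for an interpreted symbol $g\in\mathcal{F}$. Let $(K_0,P_0,R_0)\vdash(K_1,P_1,R_1)\vdash\cdots$ be a fair $\mu$-derivation (with the inference rules described below) where $P_0$ is a finite set of ground equations, $K_0=\emptyset$ and $R_0=\emptyset$. Then the length of this derivation is $O(n^2)$, where $n$ is the total number of symbols in the left- and right-hand sides of the equations of $P_0$.
   Context: A permutation equation is an equation $f(x_1,\dots,x_n)\approx f(x_{\rho(1)},\dots,x_{\rho(n)})$ with $\rho$ a permutation of $\{1,\dots,n\}$; $\approx_E$ is the equational theory generated by $E$. $B$-rules for a binary interpreted symbol $g\in\mathcal{F}$ are one of: $\{g(x,x)\to x\}$, $\{g(x,x)\to 0\}$, $\{g(x,0)\to x,g(0,x)\to x\}$, the union of the first and third, or the union of the second and third ($0$ a constant); if $g$ occurs in $E$ then $g(x_1,x_2)\approx g(x_2,x_1)\in E$. Let $W=\{c_0,c_1,\dots\}$ be infinitely many constants disjoint from $\mathcal{F}$, $K\subseteq W$ finite. A $D$-rule is $f(c_1,\dots,c_n)\to c$ with $f\in\mathcal{F}$ of arity $n\ge0$, $c_i,c\in K$; a $C$-rule is $c\to d$ with $c,d\in K$. Ordering $\succ$: $c_i\succ c_j$ if $i<j$, and $t\succ c$ whenever $t\to c$ is a $D$-rule. States are triples $(K,P,R)$ ($P$ ground equations, $R$ a set of $D$- and $C$-rules). Inference rules: EXTEND: $(K,P[t],R)\vdash(K\cup\{c\},P[c],R\cup\{t\to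 c\})$ if $t\to c$ is a $D$-rule, $c\in W\setminus K$, $t$ occurs in an equation of $P$. SIMPLIFY: $(K,P[t],R\cup\{t\to c\})\vdash(K,P[c],R\cup\{t\to c\})$ if $t$ occurs in an equation of $P$. REWRITE: $(K,P,R\cup\{l'\to r'\})\vdash(K,P\cup\{r\sigma\approx r'\},R)$ if $l'=l\sigma$ with $l\to r\in B$. ORIENT: $(K,P\cup\{s\approx t\},R)\vdash(K,P,R\cup\{s\to t\})$ if $s\succ t$ and $s\to t$ is a $D$- or $C$-rule. DEDUCE: $(K,P,R\cup\{s\to c,t\to d\})\vdash(K,P\cup\{c\approx d\},R\cup\{t\to d\})$ if $s\approx_E t$. DELETE: $(K,P\cup\{s\approx t\},R)\vdash(K,P,R)$ if $s\approx_E t$. COMPOSE: $(K,P,R\cup\{t\to c,c\to d\})\vdash(K,P,R\cup\{t\to d,c\to d\})$. COLLAPSE: $(K,P,R\cup\{t[c]\to c',c\to d\})\vdash(K,P,R\cup\{t[d]\to c',c\to d\})$ if $c$ is a proper subterm of $t$ and $c\to d$ is a $C$-rule. A derivation is fair if every inference rule that is continuously enabled is eventually applied; a fair $\mu$-derivation is a fair derivation in which EXTEND and SIMPLIFY are applied eagerly. -}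

module Defs where

open import Data.Nat using (ℕ; zero; suc; _+_; _<_; _≤_; _∸_)
open import Data.Fin using (Fin; toℕ)
open import Data.Fin.Permutation using (Permutation′; _⟨$⟩ʳ_)
open import Data.Vec using (Vec; []; _∷_; lookup; tabulate; _[_]≔_)
open import Data.List using (List; []; _∷_)
open import Data.List.Membership.Propositional using (_∈_; _∉_)
open import Data.List.Relation.Unary.Any using (Any)
open import Data.Maybe using (Maybe; just; nothing)
open import Data.Product using (Σ; ∃; _×_; _,_; proj₁; proj₂)
open import Data.Sum using (_⊎_)
open import Data.Empty using (⊥)
open import Data.Unit using (⊤)
open import Relation.Nullary using (¬_)
open import Relation.Binary.PropositionalEquality using (_≡_; _≢_; subst; sym)
open import Function.Bundles using (_⇔_)

-- Generic finite-set operations on lists (set semantics, up to a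
-- relation _~_ used as element equality).

module SetOps {A : Set} (_~_ : A → A → Set) where

  Mem : A → List A → Set
  Mem x xs = Any (λ y → x ~ y) xs

  Upd : List A → List A → List A → List A → Set
  Upd xs dels ins ys = ∀ x → Mem x ys ⇔ ((Mem x xs × ¬ Mem x dels) ⊎ Mem x ins)

module Rewriting {m : ℕ} (ar : Fin m → ℕ) where

  -- ground terms over F ∪ W ;  cst i  is the constant c_i ∈ W
  data Term : Set where
    cst : ℕ → Term
    fn  : (f : Fin m) → Vec Term (ar f) → Term

  mutual
    size : Term → ℕ
    size (cst _)   = 1
    size (fn f ts) = suc (sizes ts)

    sizes : ∀ {k} → Vec Term k → ℕ
    sizes []       = 0
    sizes (t ∷ ts) = size t + sizes ts

  data Pure : Term → Set where
    fn : ∀ f ts → (∀ i → Pure (lookup ts i)) → Pure (fn f ts)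

  -- permutation equation  f(x_1..x_n) ≈ f(x_ρ(1)..x_ρ(n))
  PermEq : Set
  PermEq = Σ (Fin m) (λ f → Permutation′ (ar f))

  data EqE (E : List PermEq) : Term → Term → Set where
    refl′  : ∀ t → EqE E t t
    sym′   : ∀ {s t} → EqE E s t → EqE E t s
    trans′ : ∀ {s t u} → EqE E s t → EqE E t u → EqE E s u
    cong′  : ∀ f ts us → (∀ i → EqE E (lookup ts i) (lookup us i)) →
             EqE E (fn f ts) (fn f us)
    ax     : ∀ {f ρ} → (f , ρ) ∈ E → ∀ ts →
             EqE E (fn f ts) (fn f (tabulate (λ i → lookup ts (ρ ⟨$⟩ʳ i))))

  vec2 : ∀ {g} → ar g ≡ 2 → Term → Term → Vec Term (ar g)
  vec2 p a b = subst (Vec Term) (sym p) (a ∷ b ∷ [])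

  nil0 : ∀ {z} → ar z ≡ 0 → Vec Term (ar z)
  nil0 q = subst (Vec Term) (sym q) []

  -- the possible sets of B-rules (g binary, z the constant 0)
  data BChoice : Set where
    none      : BChoice
    idem      : (g : Fin m) → ar g ≡ 2 → BChoice
    nilp      : (g z : Fin m) → ar g ≡ 2 → ar z ≡ 0 → BChoice
    unit      : (g z : Fin m) → ar g ≡ 2 → ar z ≡ 0 → BChoice
    idem+unit : (g z : Fin m) → ar g ≡ 2 → ar z ≡ 0 → BChoice
    nilp+unit : (g z : Fin m) → ar g ≡ 2 → ar z ≡ 0 → BChoice

  data Idem (g : Fin m) (p : ar g ≡ 2) : Term → Term → Set where
    mk : ∀ x → Idem g p (fn g (vec2 p x x)) x

  data Nilp (g z : Fin m) (p : ar g ≡ 2) (q : ar z ≡ 0) : Term → Term → Set where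
    mk : ∀ x → Nilp g z p q (fn g (vec2 p x x)) (fn z (nil0 q))

  data Unit (g z : Fin m) (p : ar g ≡ 2) (q : ar z ≡ 0) : Term → Term → Set where
    right : ∀ x → Unit g z p q (fn g (vec2 p x (fn z (nil0 q)))) x
    left  : ∀ x → Unit g z p q (fn g (vec2 p (fn z (nil0 q)) x)) x

  InstB : BChoice → Term → Term → Set
  InstB none                  l r = ⊥
  InstB (idem g p)            l r = Idem g p l r
  InstB (nilp g z p q)        l r = Nilp g z p q l r
  InstB (unit g z p q)        l r = Unit g z p q l r
  InstB (idem+unit g z p q)   l r = Idem g p l r ⊎ Unit g z p q l r
  InstB (nilp+unit g z p q)   l r = Nilp g z p q l r ⊎ Unit g z p q l r

  interpreted : BChoice → Maybe (Fin m)
  interpreted none                = nothing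
  interpreted (idem g _)          = just g
  interpreted (nilp g _ _ _)      = just g
  interpreted (unit g _ _ _)      = just g
  interpreted (idem+unit g _ _ _) = just g
  interpreted (nilp+unit g _ _ _) = just g

  -- if g occurs in E then g(x1,x2) ≈ g(x2,x1) ∈ E
  CommCond : List PermEq → BChoice → Set
  CommCond E B = ∀ g → interpreted B ≡ just g →
    Any (λ e → proj₁ e ≡ g) E →
    Any (λ e → proj₁ e ≡ g × (∀ i → toℕ (proj₂ e ⟨$⟩ʳ i) ≡ 1 ∸ toℕ i)) E

  Eqn : Set
  Eqn = Term × Term

  Rule : Set
  Rule = Term × Term

  SameEq : Eqn → Eqn → Set
  SameEq (a , b) e = (a , b) ≡ e ⊎ (b , a) ≡ e

  open SetOps SameEq using () renaming (Mem to _∈P_; Upd to UpdP) public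
  open SetOps {Rule} _≡_ using () renaming (Upd to UpdR) public
  open SetOps {ℕ} _≡_ using () renaming (Upd to UpdK) public

  eqSize : Eqn → ℕ
  eqSize (a , b) = size a + size b

  totalSize : List Eqn → ℕ
  totalSize []       = 0
  totalSize (e ∷ es) = eqSize e + totalSize es

  IsConstIn : List ℕ → Term → Set
  IsConstIn K t = ∃ λ k → t ≡ cst k × k ∈ K

  data Flat (K : List ℕ) : Term → Set where
    mk : ∀ f ts → (∀ i → IsConstIn K (lookup ts i)) → Flat K (fn f ts)

  DRule : List ℕ → Term → Term → Set
  DRule K t r = Flat K t × IsConstIn K r

  data CRule (K : List ℕ) : Term → Term → Set where
    mk : ∀ c d → c ∈ K → d ∈ K → CRule K (cst c) (cst d)

  data Gt (K : List ℕ) : Term → Term → Set where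
    cc : ∀ i j → i < j → Gt K (cst i) (cst j)
    dr : ∀ t c → DRule K t c → Gt K t c

  data Repl (s r : Term) : Term → Term → Set where
    here   : Repl s r s r
    inside : ∀ f ts i u → Repl s r (lookup ts i) u →
             Repl s r (fn f ts) (fn f (ts [ i ]≔ u))

  data ReplProper (s r : Term) : Term → Term → Set where
    inside : ∀ f ts i u → Repl s r (lookup ts i) u →
             ReplProper s r (fn f ts) (fn f (ts [ i ]≔ u))

  data ReplEq (s r : Term) : Eqn → Eqn → Set where
    lhs : ∀ a a' b → Repl s r a a' → ReplEq s r (a , b) (a' , b)
    rhs : ∀ a b b' → Repl s r b b' → ReplEq s r (a , b) (a , b')

  record State : Set where
    constructor ⟨_,_,_⟩
    field
      K : List ℕ
      P : List Eqn
      R : List Rule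

  -- labels identifying inference instances (for fairness)
  data Inf : Set where
    EXTEND   : Term → Inf
    SIMPLIFY : Rule → Eqn → Inf
    REWRITE  : Rule → Inf
    ORIENT   : Eqn → Inf
    DEDUCE   : Rule → Rule → Inf
    DELETE   : Eqn → Inf
    COMPOSE  : Rule → Rule → Inf
    COLLAPSE : Rule → Rule → Inf

  IsExtSimp : Inf → Set
  IsExtSimp (EXTEND _)     = ⊤
  IsExtSimp (SIMPLIFY _ _) = ⊤
  IsExtSimp _              = ⊥

  data Step (E : List PermEq) (B : BChoice) : Inf → State → State → Set where
    extend : ∀ {K P R K' P' R'} t c e e' →
      e ∈P P → ReplEq t (cst c) e e' → Flat K t → c ∉ K →
      UpdK K [] (c ∷ []) K' → UpdP P (e ∷ []) (e' ∷ []) P' →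
      UpdR R [] ((t , cst c) ∷ []) R' →
      Step E B (EXTEND t) ⟨ K , P , R ⟩ ⟨ K' , P' , R' ⟩
    simplify : ∀ {K P R K' P' R'} t c e e' →
      (t , cst c) ∈ R → e ∈P P → ReplEq t (cst c) e e' →
      UpdK K [] [] K' → UpdP P (e ∷ []) (e' ∷ []) P' → UpdR R [] [] R' →
      Step E B (SIMPLIFY (t , cst c) e) ⟨ K , P , R ⟩ ⟨ K' , P' , R' ⟩
    rewrite′ : ∀ {K P R K' P' R'} l' r' rσ →
      (l' , r') ∈ R → InstB B l' rσ →
      UpdK K [] [] K' → UpdP P [] ((rσ , r') ∷ []) P' →
      UpdR R ((l' , r') ∷ []) [] R' →
      Step E B (REWRITE (l' , r')) ⟨ K , P , R ⟩ ⟨ K' , P' , R' ⟩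
    orient : ∀ {K P R K' P' R'} s t →
      (s , t) ∈P P → Gt K s t → (DRule K s t ⊎ CRule K s t) →
      UpdK K [] [] K' → UpdP P ((s , t) ∷ []) [] P' →
      UpdR R [] ((s , t) ∷ []) R' →
      Step E B (ORIENT (s , t)) ⟨ K , P , R ⟩ ⟨ K' , P' , R' ⟩
    deduce : ∀ {K P R K' P' R'} s c t d →
      (s , cst c) ∈ R → (t , cst d) ∈ R → (s , cst c) ≢ (t , cst d) →
      EqE E s t →
      UpdK K [] [] K' → UpdP P [] ((cst c , cst d) ∷ []) P' →
      UpdR R ((s , cst c) ∷ []) [] R' →
      Step E B (DEDUCE (s , cst c) (t , cst d)) ⟨ K , P , R ⟩ ⟨ K' , P' , R' ⟩
    delete : ∀ {K P R K' P' R'} s t →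
      (s , t) ∈P P → EqE E s t →
      UpdK K [] [] K' → UpdP P ((s , t) ∷ []) [] P' → UpdR R [] [] R' →
      Step E B (DELETE (s , t)) ⟨ K , P , R ⟩ ⟨ K' , P' , R' ⟩
    compose : ∀ {K P R K' P' R'} t c d →
      (t , cst c) ∈ R → (cst c , cst d) ∈ R → (t , cst c) ≢ (cst c , cst d) →
      UpdK K [] [] K' → UpdP P [] [] P' →
      UpdR R ((t , cst c) ∷ []) ((t , cst d) ∷ []) R' →
      Step E B (COMPOSE (t , cst c) (cst c , cst d)) ⟨ K , P , R ⟩ ⟨ K' , P' , R' ⟩
    collapse : ∀ {K P R K' P' R'} t t' c' c d →
      (t , cst c') ∈ R → (cst c , cst d) ∈ R → CRule K (cst c) (cst d) →
      ReplProper (cst c) (cst d) t t' →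
      UpdK K [] [] K' → UpdP P [] [] P' →
      UpdR R ((t , cst c') ∷ []) ((t' , cst c') ∷ []) R' →
      Step E B (COLLAPSE (t , cst c') (cst c , cst d)) ⟨ K , P , R ⟩ ⟨ K' , P' , R' ⟩

  Enabled : List PermEq → BChoice → Inf → State → Set
  Enabled E B ι S = ∃ λ S' → Step E B ι S S'

  -- derivations: finite (len = just L, L steps) or infinite (len = nothing)

  StepIdx : Maybe ℕ → ℕ → Set
  StepIdx nothing  i = ⊤
  StepIdx (just L) i = i < L

  StateIdx : Maybe ℕ → ℕ → Set
  StateIdx nothing  i = ⊤
  StateIdx (just L) i = i ≤ L

  record Derivation (E : List PermEq) (B : BChoice) (P₀ : List Eqn) : Set where
    field
      st    : ℕ → State
      len   : Maybe ℕ
      lab   : ℕ → Inf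
      start : st 0 ≡ ⟨ [] , P₀ , [] ⟩
      steps : ∀ i → StepIdx len i → Step E B (lab i) (st i) (st (suc i))

  Fair : ∀ {E B P₀} → Derivation E B P₀ → Set
  Fair {E} {B} d = ∀ ι k → StateIdx len k →
      (∀ j → k ≤ j → StateIdx len j → Enabled E B ι (st j)) →
      ∃ λ j → k ≤ j × StepIdx len j × lab j ≡ ι
    where open Derivation d

  Eager : ∀ {E B P₀} → Derivation E B P₀ → Set
  Eager {E} {B} d = ∀ i → StepIdx len i →
      (∃ λ ι → IsExtSimp ι × Enabled E B ι (st i)) → IsExtSimp (lab i)
    where open Derivation d

  FairMu : ∀ {E B P₀} → Derivation E B P₀ → Set
  FairMu d = Fair d × Eager d

{-# OPTIONS --safe #-}
module Submission where

-- Every inference strictly decreases a natural-number potential, so a derivation from P₀ has at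
-- most as many steps as the potential of its first state, and that potential is O(n²).
--
-- The weighted symbol count M counts the symbols of P, the interpreted symbol g twice and the
-- constants of W not at all, plus one for each rule headed by g. EXTEND lowers M, no inference
-- raises it, and EXTEND is the only inference adding a constant; hence |K| + M ≤ H = M(S₀) ≤ 2n
-- throughout. The rank M + #{k ∈ K | c < k} of a constant c is therefore at most H, never
-- increases, and drops along every C-rule c → d (since c < d and d ∈ K).
--
-- The potential weighs a function symbol by Q = 3 + 6H (g by 2Q), a constant by twice its rank,
-- an equation by one more than its two sides, and a rule by its two sides minus Q − D on the head
-- of a D-rule. Every inference removes more potential than it adds, and the initial potential is
-- at most (1 + 2Q)·n.

open import Data.Fin using (Fin; zero; suc)
import Data.Fin.Properties as Fin
open import Data.List using (List; []; _∷_; _++_; filter; map; fromMaybe)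
open import Data.List.Properties using (filter-all)
import Data.List.Relation.Unary.All as All
open import Data.List.Relation.Unary.All using (All)
open import Data.List.Relation.Unary.All.Properties using (¬Any⇒All¬)
open import Data.List.Relation.Unary.AllPairs using (AllPairs)
open import Data.List.Relation.Unary.Any using (here; there)
open import Data.Maybe using (Maybe; just; nothing; maybe′)
open import Data.Maybe.Properties using (just-injective) renaming (≡-dec to ≡-decᵐ)
import Data.Maybe.Relation.Unary.All as Maybe
open import Data.Nat using (ℕ; zero; suc; _+_; _*_; _≤_; _<_; z≤n; s≤s; z<s)
open import Data.Nat.ListAction using (sum)
open import Data.Nat.Properties hiding (_≟_)
import Data.Nat.Properties as ℕ
open import Algebra.Properties.CommutativeSemigroup +-commutativeSemigroup
  using (x∙yz≈y∙xz; xy∙z≈xz∙y; xy∙z≈y∙xz; interchange)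
open import Data.Nat.Tactic.RingSolver using (solve-∀)
open import Data.Product using (_×_; _,_; proj₁; proj₂; ∃; map₂)
open import Data.Product.Properties using (≡-dec)
open import Data.Sum using (_⊎_; inj₁; inj₂)
open import Data.Unit using (tt)
open import Data.Vec using (Vec; []; _∷_; lookup; _[_]≔_)
open import Data.Vec.Properties using (lookup∘update; lookup∘update′)
open import Function using (_∘_)
open import Function.Bundles using (Equivalence)
open import Level using (0ℓ)
open import Relation.Binary.Bundles using (DecSetoid)
open import Relation.Binary.Core using (_Preserves_⟶_)
open import Relation.Binary.Definitions using (DecidableEquality)
open import Relation.Binary.PropositionalEquality
  using (_≡_; _≢_; refl; sym; trans; cong; cong₂; subst; decSetoid; module ≡-Reasoning)
open import Relation.Nullary using (¬_; yes; no; ¬?; contradiction)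
open import Relation.Nullary.Decidable using (_⊎-dec_)
open import Defs

-- The P and R of a state are sets given by lists (see SetOps.Upd), so potentials are sums over
-- the elements of a list counted once per equivalence class.
module DistinctSum (S : DecSetoid 0ℓ 0ℓ) where
  open DecSetoid S using (_≈_; _≟_; setoid)
    renaming (Carrier to A; refl to ≈-refl; sym to ≈-sym; trans to ≈-trans)
  open import Data.List.Membership.DecSetoid S using (_∈_; _∉_; _∈?_)
  open import Data.List.Membership.Setoid.Properties
    using (∈-resp-≈; ∈-filter⁺; ∈-filter⁻; ∈-++⁺ˡ; ∈-++⁺ʳ)
  open SetOps _≈_ using (Upd)

  distinctSum : (A → ℕ) → List A → ℕ
  distinctSum w [] = 0
  distinctSum w (x ∷ xs) with x ∈? xs
  ... | yes _ = distinctSum w xs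
  ... | no _  = w x + distinctSum w xs

  remove : A → List A → List A
  remove x = filter (λ y → ¬? (y ≟ x))

  private
    ≉-resp : ∀ {x y z} → y ≈ z → ¬ y ≈ x → ¬ z ≈ x
    ≉-resp y≈z y≉x z≈x = y≉x (≈-trans y≈z z≈x)

  ∈-remove⁺ : ∀ {x y xs} → y ∈ xs → ¬ y ≈ x → y ∈ remove x xs
  ∈-remove⁺ = ∈-filter⁺ setoid (λ y → ¬? (y ≟ _)) ≉-resp

  ∈-remove⁻ : ∀ {x y xs} → y ∈ remove x xs → y ∈ xs × ¬ y ≈ x
  ∈-remove⁻ = ∈-filter⁻ setoid (λ y → ¬? (y ≟ _)) ≉-resp

  remove-∉ : ∀ {x xs} → x ∉ xs → remove x xs ≡ xs
  remove-∉ {xs = xs} x∉xs =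
    filter-all (λ y → ¬? (y ≟ _)) (All.map (λ x≉y y≈x → x≉y (≈-sym y≈x)) (¬Any⇒All¬ xs x∉xs))

  distinctSum-mono : ∀ {w v} → (∀ x → w x ≤ v x) → ∀ xs → distinctSum w xs ≤ distinctSum v xs
  distinctSum-mono w≤v [] = z≤n
  distinctSum-mono w≤v (x ∷ xs) with x ∈? xs
  ... | yes _ = distinctSum-mono w≤v xs
  ... | no _  = +-mono-≤ (w≤v x) (distinctSum-mono w≤v xs)

  distinctSum≤sum : ∀ w xs → distinctSum w xs ≤ sum (map w xs)
  distinctSum≤sum w [] = z≤n
  distinctSum≤sum w (x ∷ xs) with x ∈? xs
  ... | yes _ = ≤-trans (distinctSum≤sum w xs) (m≤n+m _ (w x))
  ... | no _  = +-monoʳ-≤ (w x) (distinctSum≤sum w xs)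

  module _ {w : A → ℕ} (w-resp : w Preserves _≈_ ⟶ _≡_) where

    distinctSum-remove : ∀ {x xs} → x ∈ xs → distinctSum w xs ≡ w x + distinctSum w (remove x xs)
    distinctSum-remove {x} {y ∷ ys} x∈ with y ≟ x | y ∈? ys
    ... | yes y≈x | yes y∈ys = distinctSum-remove (∈-resp-≈ setoid y≈x y∈ys)
    ... | yes y≈x | no y∉ys  = cong₂ _+_ (w-resp y≈x) (cong (distinctSum w) (sym (remove-∉ x∉ys)))
      where
        x∉ys : x ∉ ys
        x∉ys x∈ys = y∉ys (∈-resp-≈ setoid (≈-sym y≈x) x∈ys)
    ... | no y≉x | _ with x∈
    ...   | here x≈y = contradiction (≈-sym x≈y) y≉x
    distinctSum-remove {x} {y ∷ ys} _ | no y≉x | yes y∈ys | there x∈ys with y ∈? remove x ys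
    ... | yes _ = distinctSum-remove x∈ys
    ... | no y∉ = contradiction (∈-remove⁺ y∈ys y≉x) y∉
    distinctSum-remove {x} {y ∷ ys} _ | no y≉x | no y∉ys | there x∈ys with y ∈? remove x ys
    ... | yes y∈ = contradiction (proj₁ (∈-remove⁻ y∈)) y∉ys
    ... | no _   = trans (cong (w y +_) (distinctSum-remove x∈ys)) (x∙yz≈y∙xz (w y) (w x) _)

    distinctSum-∷ : ∀ x xs → distinctSum w (x ∷ xs) ≤ w x + distinctSum w xs
    distinctSum-∷ x xs with x ∈? xs
    ... | yes _ = m≤n+m _ (w x)
    ... | no _  = ≤-refl

    distinctSum-⊆ : ∀ xs {ys} → (∀ {z} → z ∈ xs → z ∈ ys) → distinctSum w xs ≤ distinctSum w ys
    distinctSum-⊆ [] _ = z≤n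
    distinctSum-⊆ (x ∷ xs) {ys} xs⊆ys with x ∈? xs
    ... | yes _   = distinctSum-⊆ xs (xs⊆ys ∘ there)
    ... | no x∉xs = begin
      w x + distinctSum w xs            ≤⟨ +-monoʳ-≤ (w x) (distinctSum-⊆ xs xs⊆ys∖x) ⟩
      w x + distinctSum w (remove x ys) ≡⟨ sym (distinctSum-remove (xs⊆ys (here ≈-refl))) ⟩
      distinctSum w ys                  ∎
      where
        open ≤-Reasoning
        xs⊆ys∖x : ∀ {z} → z ∈ xs → z ∈ remove x ys
        xs⊆ys∖x z∈xs = ∈-remove⁺ (xs⊆ys (there z∈xs)) (λ z≈x → x∉xs (∈-resp-≈ setoid z≈x z∈xs))

    distinctSum-update : ∀ {xs ys} {del ins : Maybe A} → Upd xs (fromMaybe del) (fromMaybe ins) ys →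
                         Maybe.All (_∈ xs) del →
                         distinctSum w ys + maybe′ w 0 del ≤ distinctSum w xs + maybe′ w 0 ins
    distinctSum-update {xs} {ys} {del} {ins} upd del∈xs = begin
      distinctSum w ys + maybe′ w 0 del                            ≤⟨ +-monoˡ-≤ _ (distinctSum-⊆ ys ys⊆) ⟩
      distinctSum w (fromMaybe ins ++ rest del) + maybe′ w 0 del   ≤⟨ +-monoˡ-≤ _ (inserted ins) ⟩
      maybe′ w 0 ins + distinctSum w (rest del) + maybe′ w 0 del   ≡⟨ +-assoc (maybe′ w 0 ins) _ _ ⟩
      maybe′ w 0 ins + (distinctSum w (rest del) + maybe′ w 0 del) ≤⟨ +-monoʳ-≤ _ (deleted del∈xs) ⟩
      maybe′ w 0 ins + distinctSum w xs                            ≡⟨ +-comm (maybe′ w 0 ins) _ ⟩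
      distinctSum w xs + maybe′ w 0 ins                            ∎
      where
        open ≤-Reasoning
        rest : Maybe A → List A
        rest = maybe′ (λ x → remove x xs) xs
        kept : ∀ {z} del → z ∈ xs → ¬ z ∈ fromMaybe del → z ∈ rest del
        kept nothing  z∈xs _     = z∈xs
        kept (just x) z∈xs z∉del = ∈-remove⁺ z∈xs (z∉del ∘ here)
        ys⊆ : ∀ {z} → z ∈ ys → z ∈ fromMaybe ins ++ rest del
        ys⊆ z∈ys with Equivalence.to (upd _) z∈ys
        ... | inj₂ z∈ins          = ∈-++⁺ˡ setoid z∈ins
        ... | inj₁ (z∈xs , z∉del) = ∈-++⁺ʳ setoid (fromMaybe ins) (kept del z∈xs z∉del)
        inserted : ∀ ins → distinctSum w (fromMaybe ins ++ rest del) ≤ maybe′ w 0 ins + distinctSum w (rest del)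
        inserted nothing  = ≤-refl
        inserted (just x) = distinctSum-∷ x (rest del)
        deleted : ∀ {del} → Maybe.All (_∈ xs) del → distinctSum w (rest del) + maybe′ w 0 del ≤ distinctSum w xs
        deleted Maybe.nothing         = ≤-reflexive (+-identityʳ _)
        deleted (Maybe.just {x} x∈xs) =
          ≤-reflexive (trans (+-comm (distinctSum w (remove x xs)) (w x)) (sym (distinctSum-remove x∈xs)))

module Terms {m : ℕ} (ar : Fin m → ℕ) where
  open Rewriting ar

  mutual
    _≟ᵗ_ : DecidableEquality Term
    cst a ≟ᵗ cst b with a ℕ.≟ b
    ... | yes refl = yes refl
    ... | no a≢b   = no λ { refl → a≢b refl }
    cst _ ≟ᵗ fn _ _ = no λ ()
    fn _ _ ≟ᵗ cst _ = no λ ()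
    fn f ts ≟ᵗ fn g us with f Fin.≟ g
    ... | no f≢g = no λ { refl → f≢g refl }
    ... | yes refl with ts ≟ᵛ us
    ...   | yes refl = yes refl
    ...   | no ts≢us = no λ { refl → ts≢us refl }

    _≟ᵛ_ : ∀ {k} → DecidableEquality (Vec Term k)
    [] ≟ᵛ [] = yes refl
    (t ∷ ts) ≟ᵛ (u ∷ us) with t ≟ᵗ u | ts ≟ᵛ us
    ... | yes refl | yes refl = yes refl
    ... | no t≢u   | _        = no λ { refl → t≢u refl }
    ... | _        | no ts≢us = no λ { refl → ts≢us refl }

  rule-decSetoid : DecSetoid 0ℓ 0ℓ
  rule-decSetoid = decSetoid (≡-dec _≟ᵗ_ _≟ᵗ_)

  eqn-decSetoid : DecSetoid 0ℓ 0ℓ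
  eqn-decSetoid = record
    { Carrier          = Eqn
    ; _≈_              = SameEq
    ; isDecEquivalence = record
      { isEquivalence = record { refl = inj₁ refl ; sym = sameEq-sym ; trans = sameEq-trans }
      ; _≟_           = λ { (a , b) e → ≡-dec _≟ᵗ_ _≟ᵗ_ (a , b) e ⊎-dec ≡-dec _≟ᵗ_ _≟ᵗ_ (b , a) e }
      }
    }
    where
      sameEq-sym : ∀ {e e′} → SameEq e e′ → SameEq e′ e
      sameEq-sym (inj₁ refl) = inj₁ refl
      sameEq-sym (inj₂ refl) = inj₂ refl
      sameEq-trans : ∀ {e e′ e″} → SameEq e e′ → SameEq e′ e″ → SameEq e e″
      sameEq-trans (inj₁ refl) q           = q
      sameEq-trans (inj₂ refl) (inj₁ refl) = inj₂ refl
      sameEq-trans (inj₂ refl) (inj₂ refl) = inj₁ refl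

  constOf : Term → Maybe ℕ
  constOf (cst c)  = just c
  constOf (fn _ _) = nothing

  EqE-constOf : ∀ {E s t} → EqE E s t → constOf s ≡ constOf t
  EqE-constOf (refl′ _)        = refl
  EqE-constOf (sym′ s≈t)       = sym (EqE-constOf s≈t)
  EqE-constOf (trans′ s≈t t≈u) = trans (EqE-constOf s≈t) (EqE-constOf t≈u)
  EqE-constOf (cong′ _ _ _ _)  = refl
  EqE-constOf (ax _ _)         = refl

  module Weight (κ : ℕ → ℕ) (α : Fin m → ℕ) where

    mutual
      weight : Term → ℕ
      weight (cst c)   = κ c
      weight (fn f ts) = α f + weights ts

      weights : ∀ {k} → Vec Term k → ℕ
      weights []       = 0
      weights (t ∷ ts) = weight t + weights ts

    eqnWeight : Eqn → ℕ
    eqnWeight (a , b) = weight a + weight b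

    argWeight : Term → ℕ
    argWeight (cst _)   = 0
    argWeight (fn _ ts) = weights ts

    mutual
      weight-Repl : ∀ {s r u u′} → Repl s r u u′ → weight u′ + weight s ≡ weight u + weight r
      weight-Repl {s} {r} here = +-comm (weight r) (weight s)
      weight-Repl {s} {r} (inside f ts i u p) = begin
        α f + weights (ts [ i ]≔ u) + weight s   ≡⟨ +-assoc (α f) _ _ ⟩
        α f + (weights (ts [ i ]≔ u) + weight s) ≡⟨ cong (α f +_) (weights-Repl ts i p) ⟩
        α f + (weights ts + weight r)            ≡⟨ +-assoc (α f) _ _ ⟨
        α f + weights ts + weight r              ∎
        where open ≡-Reasoning

      weights-Repl : ∀ {s r u k} (ts : Vec Term k) i → Repl s r (lookup ts i) u →
                     weights (ts [ i ]≔ u) + weight s ≡ weights ts + weight r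
      weights-Repl {s} {r} {u} (t ∷ ts) zero p = begin
        weight u + weights ts + weight s   ≡⟨ +-assoc (weight u) _ _ ⟩
        weight u + (weights ts + weight s) ≡⟨ x∙yz≈y∙xz (weight u) (weights ts) (weight s) ⟩
        weights ts + (weight u + weight s) ≡⟨ cong (weights ts +_) (weight-Repl p) ⟩
        weights ts + (weight t + weight r) ≡⟨ x∙yz≈y∙xz (weights ts) (weight t) (weight r) ⟩
        weight t + (weights ts + weight r) ≡⟨ +-assoc (weight t) _ _ ⟨
        weight t + weights ts + weight r   ∎
        where open ≡-Reasoning
      weights-Repl {s} {r} (t ∷ ts) (suc i) p = begin
        weight t + weights (ts [ i ]≔ _) + weight s   ≡⟨ +-assoc (weight t) _ _ ⟩
        weight t + (weights (ts [ i ]≔ _) + weight s) ≡⟨ cong (weight t +_) (weights-Repl ts i p) ⟩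
        weight t + (weights ts + weight r)            ≡⟨ +-assoc (weight t) _ _ ⟨
        weight t + weights ts + weight r              ∎
        where open ≡-Reasoning

    eqnWeight-ReplEq : ∀ {s r e e′} → ReplEq s r e e′ → eqnWeight e′ + weight s ≡ eqnWeight e + weight r
    eqnWeight-ReplEq {s} {r} (lhs a a′ b p) = begin
      weight a′ + weight b + weight s ≡⟨ xy∙z≈xz∙y (weight a′) (weight b) (weight s) ⟩
      weight a′ + weight s + weight b ≡⟨ cong (_+ weight b) (weight-Repl p) ⟩
      weight a + weight r + weight b  ≡⟨ xy∙z≈xz∙y (weight a) (weight b) (weight r) ⟨
      weight a + weight b + weight r  ∎
      where open ≡-Reasoning
    eqnWeight-ReplEq {s} {r} (rhs a b b′ p) = begin
      weight a + weight b′ + weight s   ≡⟨ +-assoc (weight a) _ _ ⟩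
      weight a + (weight b′ + weight s) ≡⟨ cong (weight a +_) (weight-Repl p) ⟩
      weight a + (weight b + weight r)  ≡⟨ +-assoc (weight a) _ _ ⟨
      weight a + weight b + weight r    ∎
      where open ≡-Reasoning

    weights-vec2 : ∀ {k} (p : k ≡ 2) a b → weights (subst (Vec Term) (sym p) (a ∷ b ∷ [])) ≡ weight a + weight b
    weights-vec2 refl a b = cong (weight a +_) (+-identityʳ (weight b))

    weights-nil0 : ∀ {k} (q : k ≡ 0) → weights (subst (Vec Term) (sym q) []) ≡ 0
    weights-nil0 refl = refl

    module _ {X : ℕ} (κ≤X : ∀ c → κ c ≤ X) (α≤X : ∀ f → α f ≤ X) where
      mutual
        weight≤size : ∀ t → weight t ≤ X * size t
        weight≤size (cst c)   = ≤-trans (κ≤X c) (≤-reflexive (sym (*-identityʳ X)))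
        weight≤size (fn f ts) =
          ≤-trans (+-mono-≤ (α≤X f) (weights≤sizes ts)) (≤-reflexive (sym (*-suc X (sizes ts))))

        weights≤sizes : ∀ {k} (ts : Vec Term k) → weights ts ≤ X * sizes ts
        weights≤sizes []       = z≤n
        weights≤sizes (t ∷ ts) = ≤-trans (+-mono-≤ (weight≤size t) (weights≤sizes ts))
                                         (≤-reflexive (sym (*-distribˡ-+ X (size t) (sizes ts))))

  module _ {κ κ′ : ℕ → ℕ} (α : Fin m → ℕ) (κ≤κ′ : ∀ c → κ c ≤ κ′ c) where
    private
      module W  = Weight κ α
      module W′ = Weight κ′ α

    mutual
      weight-monoᶜ : ∀ t → W.weight t ≤ W′.weight t
      weight-monoᶜ (cst c)   = κ≤κ′ c
      weight-monoᶜ (fn f ts) = +-monoʳ-≤ (α f) (weights-monoᶜ ts)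

      weights-monoᶜ : ∀ {k} (ts : Vec Term k) → W.weights ts ≤ W′.weights ts
      weights-monoᶜ []       = z≤n
      weights-monoᶜ (t ∷ ts) = +-mono-≤ (weight-monoᶜ t) (weights-monoᶜ ts)

  interpCount : Maybe (Fin m) → Fin m → ℕ
  interpCount g? f with ≡-decᵐ Fin._≟_ g? (just f)
  ... | yes _ = 1
  ... | no _  = 0

  interpCount≤1 : ∀ g? f → interpCount g? f ≤ 1
  interpCount≤1 g? f with ≡-decᵐ Fin._≟_ g? (just f)
  ... | yes _ = ≤-refl
  ... | no _  = z≤n

  interpCount-just : ∀ {g? f} → g? ≡ just f → interpCount g? f ≡ 1
  interpCount-just {g?} {f} g?≡f with ≡-decᵐ Fin._≟_ g? (just f)
  ... | yes _   = refl
  ... | no g?≢f = contradiction g?≡f g?≢f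

  interpCount-other : ∀ {g f} → g ≢ f → interpCount (just g) f ≡ 0
  interpCount-other {g} {f} g≢f with ≡-decᵐ Fin._≟_ (just g) (just f)
  ... | yes g≡f = contradiction (just-injective g≡f) g≢f
  ... | no _    = refl

  headCount : Maybe (Fin m) → Term → ℕ
  headCount g? (cst _)  = 0
  headCount g? (fn f _) = interpCount g? f

  module _ (κ : ℕ → ℕ) (α : Fin m → ℕ) where
    open Weight κ α

    ContractumWeight : Maybe (Fin m) → Term → Term → Set
    ContractumWeight g? l rσ = weight rσ ≤ argWeight l ⊎ ∃ λ z → interpCount g? z ≡ 0 × weight rσ ≡ α z

    private
      Redex : Fin m → Term → Term → Set
      Redex g l rσ = headCount (just g) l ≡ 1 × ContractumWeight (just g) l rσ

      idem-weight : ∀ {g p l rσ} → Idem g p l rσ → Redex g l rσ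
      idem-weight {p = p} (mk x) =
        interpCount-just refl , inj₁ (≤-trans (m≤m+n _ _) (≤-reflexive (sym (weights-vec2 p x x))))

      nilp-weight : ∀ {g z p q l rσ} → Nilp g z p q l rσ → Redex g l rσ
      nilp-weight {g} {z} {p} {q} (mk x) =
        interpCount-just refl , inj₂ (z , interpCount-other g≢z , weight-0)
        where
          g≢z : g ≢ z
          g≢z refl with () ← trans (sym p) q
          weight-0 : weight (fn z (nil0 q)) ≡ α z
          weight-0 = trans (cong (α z +_) (weights-nil0 q)) (+-identityʳ (α z))

      unit-weight : ∀ {g z p q l rσ} → Unit g z p q l rσ → Redex g l rσ
      unit-weight {p = p} (right x) =
        interpCount-just refl , inj₁ (≤-trans (m≤m+n _ _) (≤-reflexive (sym (weights-vec2 p x _))))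
      unit-weight {p = p} (left x) =
        interpCount-just refl , inj₁ (≤-trans (m≤n+m _ _) (≤-reflexive (sym (weights-vec2 p _ x))))

    redex-weight : ∀ B {l rσ} → InstB B l rσ →
                   headCount (interpreted B) l ≡ 1 × ContractumWeight (interpreted B) l rσ
    redex-weight (idem g p)          i        = idem-weight i
    redex-weight (nilp g z p q)      n        = nilp-weight n
    redex-weight (unit g z p q)      u        = unit-weight u
    redex-weight (idem+unit g z p q) (inj₁ i) = idem-weight i
    redex-weight (idem+unit g z p q) (inj₂ u) = unit-weight u
    redex-weight (nilp+unit g z p q) (inj₁ n) = nilp-weight n
    redex-weight (nilp+unit g z p q) (inj₂ u) = unit-weight u

module Inferences {m : ℕ} (ar : Fin m → ℕ) where
  open Rewriting ar
  open import Data.List.Membership.Propositional using (_∈_)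

  record Change (S S′ : State) : Set where
    field
      newK      : Maybe ℕ
      delP insP : Maybe Eqn
      delR insR : Maybe Rule
      updK      : UpdK (State.K S) [] (fromMaybe newK) (State.K S′)
      updP      : UpdP (State.P S) (fromMaybe delP) (fromMaybe insP) (State.P S′)
      updR      : UpdR (State.R S) (fromMaybe delR) (fromMaybe insR) (State.R S′)
      delP∈P    : Maybe.All (_∈P State.P S) delP
      delR∈R    : Maybe.All (_∈ State.R S) delR

  module _ {E : List PermEq} {B : BChoice} where

    change : ∀ {ι S S′} → Step E B ι S S′ → Change S S′
    change (extend t c e e′ e∈P _ _ _ uK uP uR) = record
      { newK = just c ; delP = just e ; insP = just e′ ; delR = nothing ; insR = just (t , cst c)
      ; updK = uK ; updP = uP ; updR = uR ; delP∈P = Maybe.just e∈P ; delR∈R = Maybe.nothing }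
    change (simplify t c e e′ _ e∈P _ uK uP uR) = record
      { newK = nothing ; delP = just e ; insP = just e′ ; delR = nothing ; insR = nothing
      ; updK = uK ; updP = uP ; updR = uR ; delP∈P = Maybe.just e∈P ; delR∈R = Maybe.nothing }
    change (rewrite′ l′ r′ rσ l′r′∈R _ uK uP uR) = record
      { newK = nothing ; delP = nothing ; insP = just (rσ , r′) ; delR = just (l′ , r′) ; insR = nothing
      ; updK = uK ; updP = uP ; updR = uR ; delP∈P = Maybe.nothing ; delR∈R = Maybe.just l′r′∈R }
    change (orient s t st∈P _ _ uK uP uR) = record
      { newK = nothing ; delP = just (s , t) ; insP = nothing ; delR = nothing ; insR = just (s , t)
      ; updK = uK ; updP = uP ; updR = uR ; delP∈P = Maybe.just st∈P ; delR∈R = Maybe.nothing }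
    change (deduce s c t d sc∈R _ _ _ uK uP uR) = record
      { newK = nothing ; delP = nothing ; insP = just (cst c , cst d) ; delR = just (s , cst c) ; insR = nothing
      ; updK = uK ; updP = uP ; updR = uR ; delP∈P = Maybe.nothing ; delR∈R = Maybe.just sc∈R }
    change (delete s t st∈P _ uK uP uR) = record
      { newK = nothing ; delP = just (s , t) ; insP = nothing ; delR = nothing ; insR = nothing
      ; updK = uK ; updP = uP ; updR = uR ; delP∈P = Maybe.just st∈P ; delR∈R = Maybe.nothing }
    change (compose t c d tc∈R _ _ uK uP uR) = record
      { newK = nothing ; delP = nothing ; insP = nothing ; delR = just (t , cst c) ; insR = just (t , cst d)
      ; updK = uK ; updP = uP ; updR = uR ; delP∈P = Maybe.nothing ; delR∈R = Maybe.just tc∈R }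
    change (collapse t t′ c′ _ _ tc′∈R _ _ _ uK uP uR) = record
      { newK = nothing ; delP = nothing ; insP = nothing ; delR = just (t , cst c′) ; insR = just (t′ , cst c′)
      ; updK = uK ; updP = uP ; updR = uR ; delP∈P = Maybe.nothing ; delR∈R = Maybe.just tc′∈R }

  data Oriented (K : List ℕ) : Rule → Set where
    drule : ∀ {l r} → DRule K l r → Oriented K (l , r)
    crule : ∀ {c d} → c < d → d ∈ K → Oriented K (cst c , cst d)

  OrientedRules : List ℕ → List Rule → Set
  OrientedRules K R = ∀ {r} → r ∈ R → Oriented K r

  module _ {K K′ : List ℕ} (K⊆K′ : ∀ {c} → c ∈ K → c ∈ K′) where

    IsConstIn-mono : ∀ {t} → IsConstIn K t → IsConstIn K′ t
    IsConstIn-mono (c , t≡c , c∈K) = c , t≡c , K⊆K′ c∈K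

    Flat-mono : ∀ {t} → Flat K t → Flat K′ t
    Flat-mono (mk f ts args) = mk f ts (IsConstIn-mono ∘ args)

    Oriented-mono : ∀ {r} → Oriented K r → Oriented K′ r
    Oriented-mono (drule (t-flat , r-const)) = drule (Flat-mono t-flat , IsConstIn-mono r-const)
    Oriented-mono (crule c<d d∈K)            = crule c<d (K⊆K′ d∈K)

  Repl-cst : ∀ {s r k u} → Repl s r (cst k) u → u ≡ r
  Repl-cst here = refl

  Flat-collapse : ∀ {K c d t t′} → d ∈ K → ReplProper (cst c) (cst d) t t′ → Flat K t → Flat K t′
  Flat-collapse {K} {d = d} d∈K (inside f ts i u p) (mk .f .ts args) = mk f (ts [ i ]≔ u) args′
    where
      args′ : ∀ j → IsConstIn K (lookup (ts [ i ]≔ u) j)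
      args′ j with j Fin.≟ i
      ... | no j≢i   = subst (IsConstIn K) (sym (lookup∘update′ j≢i ts u)) (args j)
      ... | yes refl with args i
      ...   | _ , tᵢ≡k , _ = d , trans (lookup∘update i ts u) (Repl-cst (subst (λ v → Repl _ _ v u) tᵢ≡k p)) , d∈K

  module _ {E : List PermEq} {B : BChoice} where

    K-grows : ∀ {ι K P R K′ P′ R′} → Step E B ι ⟨ K , P , R ⟩ ⟨ K′ , P′ , R′ ⟩ →
              ∀ {c} → c ∈ K → c ∈ K′
    K-grows st c∈K = Equivalence.from (Change.updK (change st) _) (inj₁ (c∈K , λ ()))

    inserted-oriented : ∀ {ι K P R K′ P′ R′} → OrientedRules K R →
                        (st : Step E B ι ⟨ K , P , R ⟩ ⟨ K′ , P′ , R′ ⟩) →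
                        Maybe.All (Oriented K′) (Change.insR (change st))
    inserted-oriented _ st@(extend t c _ _ _ _ t-flat _ uK _ _) =
      Maybe.just (drule (Flat-mono (K-grows st) t-flat , c , refl , Equivalence.from (uK c) (inj₂ (here refl))))
    inserted-oriented _ (simplify _ _ _ _ _ _ _ _ _ _) = Maybe.nothing
    inserted-oriented _ (rewrite′ _ _ _ _ _ _ _ _) = Maybe.nothing
    inserted-oriented _ st@(orient s t _ s≻t s→t _ _ _) =
      Maybe.just (Oriented-mono (K-grows st) (oriented s≻t s→t))
      where
        oriented : ∀ {K s t} → Gt K s t → DRule K s t ⊎ CRule K s t → Oriented K (s , t)
        oriented _                 (inj₁ s→t)            = drule s→t
        oriented (cc _ _ c<d)      (inj₂ (mk _ _ _ d∈K)) = crule c<d d∈K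
        oriented (dr _ _ (() , _)) (inj₂ (mk _ _ _ _))
    inserted-oriented _ (deduce _ _ _ _ _ _ _ _ _ _ _) = Maybe.nothing
    inserted-oriented _ (delete _ _ _ _ _ _ _) = Maybe.nothing
    inserted-oriented R↓ st@(compose t c d tc∈R cd∈R _ _ _ _) =
      Maybe.just (Oriented-mono (K-grows st) (oriented-trans (R↓ tc∈R) (R↓ cd∈R)))
      where
        oriented-trans : ∀ {K t c d} → Oriented K (t , cst c) → Oriented K (cst c , cst d) → Oriented K (t , cst d)
        oriented-trans (drule (t-flat , _)) (crule _ d∈K)   = drule (t-flat , _ , refl , d∈K)
        oriented-trans (crule b<c _)        (crule c<d d∈K) = crule (<-trans b<c c<d) d∈K
        oriented-trans _                    (drule (() , _))
    inserted-oriented R↓ st@(collapse t t′ c′ c d tc′∈R _ (mk _ _ _ d∈K) t→t′ _ _ _) =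
      Maybe.just (Oriented-mono (K-grows st) (oriented-collapse d∈K (R↓ tc′∈R) t→t′))
      where
        oriented-collapse : ∀ {K t t′ c′ c d} → d ∈ K → Oriented K (t , cst c′) →
                            ReplProper (cst c) (cst d) t t′ → Oriented K (t′ , cst c′)
        oriented-collapse d∈K (drule (t-flat , c′-const)) t→t′ = drule (Flat-collapse d∈K t→t′ t-flat , c′-const)
        oriented-collapse _   (crule _ _) ()

    oriented-step : ∀ {ι K P R K′ P′ R′} → OrientedRules K R →
                    Step E B ι ⟨ K , P , R ⟩ ⟨ K′ , P′ , R′ ⟩ → OrientedRules K′ R′
    oriented-step R↓ st r∈R′ with Equivalence.to (Change.updR (change st) _) r∈R′
    ... | inj₁ (r∈R , _) = Oriented-mono (K-grows st) (R↓ r∈R)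
    ... | inj₂ r∈ins     = All-fromMaybe (inserted-oriented R↓ st) r∈ins
      where
        All-fromMaybe : ∀ {A : Set} {P : A → Set} {m x} → Maybe.All P m → x ∈ fromMaybe m → P x
        All-fromMaybe (Maybe.just px) (here refl) = px

module Termination {m : ℕ} (ar : Fin m → ℕ) (E : List (Rewriting.PermEq ar)) (B : Rewriting.BChoice ar) where
  open Rewriting ar
  open Terms ar
  open Inferences ar
  open Change
  open import Data.List.Membership.Propositional using (_∈_)
  module Pᵈ = DistinctSum eqn-decSetoid
  module Rᵈ = DistinctSum rule-decSetoid
  module Kᵈ = DistinctSum ≡-decSetoid

  module Accounting (u : Eqn → ℕ) (u-sym : ∀ a b → u (a , b) ≡ u (b , a)) (v : Rule → ℕ) where

    potential : State → ℕ
    potential S = Pᵈ.distinctSum u (State.P S) + Rᵈ.distinctSum v (State.R S)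

    added removed : ∀ {S S′} → Change S S′ → ℕ
    added ch   = maybe′ u 0 (insP ch) + maybe′ v 0 (insR ch)
    removed ch = maybe′ u 0 (delP ch) + maybe′ v 0 (delR ch)

    potential-step : ∀ {S S′} (ch : Change S S′) a → a + added ch ≤ removed ch → a + potential S′ ≤ potential S
    potential-step {S} {S′} ch a local = +-cancelʳ-≤ (added ch) _ _ (begin
      a + (p′ + r′) + (iP + iR)   ≡⟨ xy∙z≈y∙xz a (p′ + r′) (iP + iR) ⟩
      (p′ + r′) + (a + (iP + iR)) ≤⟨ +-monoʳ-≤ (p′ + r′) local ⟩
      (p′ + r′) + (dP + dR)       ≡⟨ interchange p′ r′ dP dR ⟩
      (p′ + dP) + (r′ + dR)       ≤⟨ +-mono-≤ P-step R-step ⟩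
      (p + iP) + (r + iR)         ≡⟨ interchange p iP r iR ⟩
      p + r + (iP + iR)           ∎)
      where
        open ≤-Reasoning
        p p′ r r′ iP iR dP dR : ℕ
        p  = Pᵈ.distinctSum u (State.P S)
        p′ = Pᵈ.distinctSum u (State.P S′)
        r  = Rᵈ.distinctSum v (State.R S)
        r′ = Rᵈ.distinctSum v (State.R S′)
        iP = maybe′ u 0 (insP ch)
        iR = maybe′ v 0 (insR ch)
        dP = maybe′ u 0 (delP ch)
        dR = maybe′ v 0 (delR ch)
        u-resp : ∀ {e e′} → SameEq e e′ → u e ≡ u e′
        u-resp {a , b} (inj₁ refl) = refl
        u-resp {a , b} (inj₂ refl) = u-sym a b
        P-step : p′ + dP ≤ p + iP
        P-step = Pᵈ.distinctSum-update u-resp (updP ch) (delP∈P ch)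
        R-step : r′ + dR ≤ r + iR
        R-step = Rᵈ.distinctSum-update (cong v) (updR ch) (delR∈R ch)

  fresh : ∀ {S S′} → Change S S′ → ℕ
  fresh ch = maybe′ (λ _ → 1) 0 (newK ch)

  K-growth : ∀ {S S′} w → (∀ k → w k ≤ 1) → (ch : Change S S′) →
             Kᵈ.distinctSum w (State.K S′) ≤ fresh ch + Kᵈ.distinctSum w (State.K S)
  K-growth {S} {S′} w w≤1 ch = begin
    Kᵈ.distinctSum w (State.K S′)                       ≤⟨ m≤m+n _ 0 ⟩
    Kᵈ.distinctSum w (State.K S′) + 0                   ≤⟨ Kᵈ.distinctSum-update (cong w) (updK ch) Maybe.nothing ⟩
    Kᵈ.distinctSum w (State.K S) + maybe′ w 0 (newK ch) ≤⟨ +-monoʳ-≤ _ (new≤fresh (newK ch)) ⟩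
    Kᵈ.distinctSum w (State.K S) + fresh ch             ≡⟨ +-comm _ (fresh ch) ⟩
    fresh ch + Kᵈ.distinctSum w (State.K S)             ∎
    where
      open ≤-Reasoning
      new≤fresh : ∀ c? → maybe′ w 0 c? ≤ maybe′ (λ _ → 1) 0 c?
      new≤fresh (just c) = w≤1 c
      new≤fresh nothing  = z≤n

  isInterp : Fin m → ℕ
  isInterp = interpCount (interpreted B)

  symbolWeight : Fin m → ℕ
  symbolWeight f = suc (isInterp f)

  module Symbols = Weight (λ _ → 0) symbolWeight

  -- The unit kept by a rule headed by g pays for the constant 0 that REWRITE may produce from it.
  ruleSymbols : Rule → ℕ
  ruleSymbols (l , _) = headCount (interpreted B) l

  eqnSymbols-sym : ∀ a b → Symbols.eqnWeight (a , b) ≡ Symbols.eqnWeight (b , a)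
  eqnSymbols-sym a b = +-comm (Symbols.weight a) (Symbols.weight b)

  module SymbolAccounting = Accounting Symbols.eqnWeight eqnSymbols-sym ruleSymbols

  symbolCount : State → ℕ
  symbolCount = SymbolAccounting.potential

  headCount≤symbols : ∀ t → headCount (interpreted B) t ≤ Symbols.weight t
  headCount≤symbols (cst _)   = z≤n
  headCount≤symbols (fn f ts) = ≤-trans (n≤1+n (isInterp f)) (m≤m+n _ _)

  flat-argSymbols : ∀ {K l} → Flat K l → Symbols.argWeight l ≡ 0
  flat-argSymbols (mk f ts args) = constants ts args
    where
      constants : ∀ {K k} (ts : Vec Term k) → (∀ i → IsConstIn K (lookup ts i)) → Symbols.weights ts ≡ 0
      constants []       _    = refl
      constants (t ∷ ts) args with args zero
      ... | _ , refl , _ = constants ts (args ∘ suc)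

  contractum-symbols : ∀ {K l rσ} → Flat K l → InstB B l rσ → Symbols.weight rσ ≤ headCount (interpreted B) l
  contractum-symbols l-flat inst with redex-weight (λ _ → 0) symbolWeight B inst
  ... | _ , inj₁ w≤arg = ≤-trans w≤arg (≤-trans (≤-reflexive (flat-argSymbols l-flat)) z≤n)
  ... | head≡1 , inj₂ (z , z-uninterp , w≡) = ≤-reflexive (trans w≡ (trans (cong suc z-uninterp) (sym head≡1)))

  symbolCount-local : ∀ {ι K P R S′} → OrientedRules K R → (st : Step E B ι ⟨ K , P , R ⟩ S′) →
                      fresh (change st) + SymbolAccounting.added (change st) ≤ SymbolAccounting.removed (change st)
  symbolCount-local _ (extend _ _ _ e′ _ e→e′ (mk f ts _) _ _ _ _) = begin
    suc (x′ + isInterp f)                      ≡⟨ +-suc x′ _ ⟨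
    x′ + symbolWeight f                        ≤⟨ +-monoʳ-≤ x′ (m≤m+n _ (Symbols.weights ts)) ⟩
    x′ + (symbolWeight f + Symbols.weights ts) ≡⟨ Symbols.eqnWeight-ReplEq e→e′ ⟩
    _                                          ∎
    where
      open ≤-Reasoning
      x′ : ℕ
      x′ = Symbols.eqnWeight e′
  symbolCount-local _ (simplify _ _ _ _ _ _ e→e′ _ _ _) =
    ≤-trans (+-monoʳ-≤ _ z≤n) (≤-reflexive (Symbols.eqnWeight-ReplEq e→e′))
  symbolCount-local R↓ (rewrite′ _ _ _ l→r∈R inst _ _ _) with R↓ l→r∈R
  ... | drule (l-flat , _ , refl , _) =
    ≤-trans (≤-reflexive (trans (+-identityʳ _) (+-identityʳ _))) (contractum-symbols l-flat inst)
  ... | crule _ _ with () ← proj₁ (redex-weight (λ _ → 0) symbolWeight B inst)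
  symbolCount-local _ (orient s t _ _ _ _ _ _) =
    ≤-trans (headCount≤symbols s) (≤-trans (m≤m+n _ (Symbols.weight t)) (m≤m+n _ 0))
  symbolCount-local _ (deduce _ _ _ _ _ _ _ _ _ _ _) = z≤n
  symbolCount-local _ (delete _ _ _ _ _ _ _) = z≤n
  symbolCount-local _ (compose _ _ _ _ _ _ _ _ _) = ≤-refl
  symbolCount-local _ (collapse _ _ _ _ _ _ _ _ (inside _ _ _ _ _) _ _ _) = ≤-refl

  symbolCount-step : ∀ {ι S S′} → OrientedRules (State.K S) (State.R S) → (st : Step E B ι S S′) →
                     fresh (change st) + symbolCount S′ ≤ symbolCount S
  symbolCount-step R↓ st =
    SymbolAccounting.potential-step (change st) (fresh (change st)) (symbolCount-local R↓ st)

  card : List ℕ → ℕ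
  card = Kᵈ.distinctSum (λ _ → 1)

  isAbove : ℕ → ℕ → ℕ
  isAbove c k with c <? k
  ... | yes _ = 1
  ... | no _  = 0

  above : List ℕ → ℕ → ℕ
  above K c = Kᵈ.distinctSum (isAbove c) K

  isAbove≤1 : ∀ c k → isAbove c k ≤ 1
  isAbove≤1 c k with c <? k
  ... | yes _ = ≤-refl
  ... | no _  = z≤n

  above≤card : ∀ K c → above K c ≤ card K
  above≤card K c = Kᵈ.distinctSum-mono (isAbove≤1 c) K

  above-strict : ∀ {K c d} → c < d → d ∈ K → suc (above K d) ≤ above K c
  above-strict {K} {c} {d} c<d d∈K = begin
    suc (above K d)                       ≡⟨ cong suc (Kᵈ.distinctSum-remove (cong (isAbove d)) d∈K) ⟩
    suc (isAbove d d + above K∖d d)       ≡⟨ cong (λ n → suc (n + above K∖d d)) (isAbove-self d) ⟩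
    suc (above K∖d d)                     ≤⟨ s≤s (Kᵈ.distinctSum-mono (isAbove-anti c<d) K∖d) ⟩
    suc (above K∖d c)                     ≡⟨ cong (_+ above K∖d c) (isAbove-< c<d) ⟨
    isAbove c d + above K∖d c             ≡⟨ Kᵈ.distinctSum-remove (cong (isAbove c)) d∈K ⟨
    above K c                             ∎
    where
      open ≤-Reasoning
      K∖d : List ℕ
      K∖d = Kᵈ.remove d K
      isAbove-self : ∀ d → isAbove d d ≡ 0
      isAbove-self d with d <? d
      ... | yes d<d = contradiction d<d (<-irrefl refl)
      ... | no _    = refl
      isAbove-< : ∀ {c d} → c < d → isAbove c d ≡ 1
      isAbove-< {c} {d} c<d with c <? d
      ... | yes _  = refl
      ... | no c≮d = contradiction c<d c≮d
      isAbove-anti : ∀ {c d} → c < d → ∀ k → isAbove d k ≤ isAbove c k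
      isAbove-anti {c} {d} c<d k with d <? k | c <? k
      ... | yes _   | yes _  = ≤-refl
      ... | yes d<k | no c≮k = contradiction (<-trans c<d d<k) c≮k
      ... | no _    | _      = z≤n

  record Invariant (H : ℕ) (S : State) : Set where
    field
      oriented : OrientedRules (State.K S) (State.R S)
      budget   : card (State.K S) + symbolCount S ≤ H
  open Invariant

  invariant-initial : ∀ P₀ → Invariant (symbolCount ⟨ [] , P₀ , [] ⟩) ⟨ [] , P₀ , [] ⟩
  invariant-initial P₀ = record { oriented = λ () ; budget = ≤-refl }

  invariant-step : ∀ {H ι S S′} → Invariant H S → Step E B ι S S′ → Invariant H S′
  invariant-step {H} {S = S} {S′} inv st = record
    { oriented = oriented-step (oriented inv) st
    ; budget   = begin
        card K′ + symbolCount S′              ≤⟨ +-monoˡ-≤ _ (K-growth (λ _ → 1) (λ _ → ≤-refl) (change st)) ⟩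
        new + card K + symbolCount S′         ≡⟨ xy∙z≈y∙xz new (card K) _ ⟩
        card K + (new + symbolCount S′)       ≤⟨ +-monoʳ-≤ (card K) (symbolCount-step (oriented inv) st) ⟩
        card K + symbolCount S                ≤⟨ budget inv ⟩
        H                                     ∎
    }
    where
      open ≤-Reasoning
      K K′ : List ℕ
      K  = State.K S
      K′ = State.K S′
      new : ℕ
      new = fresh (change st)

  rank : State → ℕ → ℕ
  rank S c = symbolCount S + above (State.K S) c

  rank-bounded : ∀ {H S} → Invariant H S → ∀ c → rank S c ≤ H
  rank-bounded {S = S} inv c = begin
    symbolCount S + above (State.K S) c ≤⟨ +-monoʳ-≤ (symbolCount S) (above≤card (State.K S) c) ⟩
    symbolCount S + card (State.K S)    ≡⟨ +-comm (symbolCount S) _ ⟩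
    card (State.K S) + symbolCount S    ≤⟨ budget inv ⟩
    _                                   ∎
    where open ≤-Reasoning

  rank-descends : ∀ {S c d} → c < d → d ∈ State.K S → rank S d < rank S c
  rank-descends {S} c<d d∈K = +-monoʳ-< (symbolCount S) (above-strict c<d d∈K)

  rank-step : ∀ {H ι S S′} → Invariant H S → Step E B ι S S′ → ∀ c → rank S′ c ≤ rank S c
  rank-step {S = S} {S′} inv st c = begin
    symbolCount S′ + above K′ c        ≤⟨ +-monoʳ-≤ (symbolCount S′) K-step ⟩
    symbolCount S′ + (new + above K c) ≡⟨ x∙yz≈y∙xz (symbolCount S′) new (above K c) ⟩
    new + (symbolCount S′ + above K c) ≡⟨ +-assoc new _ _ ⟨
    new + symbolCount S′ + above K c   ≤⟨ +-monoˡ-≤ (above K c) (symbolCount-step (oriented inv) st) ⟩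
    symbolCount S + above K c          ∎
    where
      open ≤-Reasoning
      K K′ : List ℕ
      K  = State.K S
      K′ = State.K S′
      new : ℕ
      new = fresh (change st)
      K-step : above K′ c ≤ new + above K c
      K-step = K-growth (isAbove c) (isAbove≤1 c) (change st)

  -- Constants weigh twice their rank h (bounded by H) so that a C-rule x → d, with h d < h x, pays
  -- for the equation c ≈ d that DEDUCE produces from x → c; D ≥ 2 + 2 h d does the same for a D-rule,
  -- and Q ≥ 1 + D + 4 h c makes EXTEND with the new constant c decrease the potential.
  module Potential (H : ℕ) (h : ℕ → ℕ) where

    Q D : ℕ
    Q = 3 + 6 * H
    D = 2 + 2 * H

    open Weight (λ c → 2 * h c) (λ f → symbolWeight f * Q) public

    lhsPot : Term → ℕ
    lhsPot (cst c)   = 2 * h c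
    lhsPot (fn f ts) = D + isInterp f * Q + weights ts

    rulePot : Rule → ℕ
    rulePot (l , r) = lhsPot l + weight r

    eqnPot : Eqn → ℕ
    eqnPot e = suc (eqnWeight e)

    eqnPot-sym : ∀ a b → eqnPot (a , b) ≡ eqnPot (b , a)
    eqnPot-sym a b = cong suc (+-comm (weight a) (weight b))

    module PotAccounting = Accounting eqnPot eqnPot-sym rulePot

    potential : State → ℕ
    potential = PotAccounting.potential

    D≤Q : D ≤ Q
    D≤Q = +-mono-≤ (n≤1+n 2) (*-monoˡ-≤ H (s≤s (s≤s (z≤n {4}))))

    lhsPot≤weight : ∀ l → lhsPot l ≤ weight l
    lhsPot≤weight (cst _)   = ≤-refl
    lhsPot≤weight (fn f ts) = +-monoˡ-≤ (weights ts) (+-monoˡ-≤ (isInterp f * Q) D≤Q)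

    extension-room : ∀ {n} → n ≤ H → suc (D + (2 * n + 2 * n)) ≤ Q
    extension-room {n} n≤H = begin
      suc (D + (2 * n + 2 * n)) ≤⟨ s≤s (+-monoʳ-≤ D (+-mono-≤ 2n≤2H 2n≤2H)) ⟩
      suc (D + (2 * H + 2 * H)) ≡⟨ normalise H ⟩
      Q                         ∎
      where
        open ≤-Reasoning
        2n≤2H : 2 * n ≤ 2 * H
        2n≤2H = *-monoʳ-≤ 2 n≤H
        normalise : ∀ H → suc (2 + 2 * H + (2 * H + 2 * H)) ≡ 3 + 6 * H
        normalise = solve-∀

    private
      extend-arith : ∀ {x y k w c} → x + (Q + k + w) ≡ y + c → suc (D + (c + c)) ≤ Q →
                     suc (suc x + (D + k + w + c)) ≤ suc y + 0
      extend-arith {x} {y} {k} {w} {c} eq room = +-cancelʳ-≤ c _ _ (begin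
        suc (suc x + (D + k + w + c)) + c   ≡⟨ regroup₁ x k w c D ⟩
        x + k + w + suc (suc (D + (c + c))) ≤⟨ +-monoʳ-≤ (x + k + w) (s≤s room) ⟩
        x + k + w + suc Q                   ≡⟨ regroup₂ x k w Q ⟩
        suc (x + (Q + k + w))               ≡⟨ cong suc eq ⟩
        suc (y + c)                         ≡⟨ cong (_+ c) (+-identityʳ (suc y)) ⟨
        suc y + 0 + c                       ∎)
        where
          open ≤-Reasoning
          regroup₁ : ∀ x k w c D → suc (suc x + (D + k + w + c)) + c ≡ x + k + w + suc (suc (D + (c + c)))
          regroup₁ = solve-∀
          regroup₂ : ∀ x k w Q → x + k + w + suc Q ≡ suc (x + (Q + k + w))
          regroup₂ = solve-∀

      simplify-arith : ∀ {x y a t} → x + t ≡ y + a → a < t → suc (suc x + 0) ≤ suc y + 0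
      simplify-arith {x} {y} {a} {t} eq a<t = begin
        suc (suc x + 0) ≡⟨ cong suc (+-identityʳ (suc x)) ⟩
        suc (suc x)     ≤⟨ s≤s (+-cancelʳ-< t x y x+t<y+t) ⟩
        suc y           ≡⟨ +-identityʳ (suc y) ⟨
        suc y + 0       ∎
        where
          open ≤-Reasoning
          x+t<y+t : x + t < y + t
          x+t<y+t = subst (_< y + t) (sym eq) (+-monoʳ-< y a<t)

      rewrite-arith : ∀ {ρ r L} → 2 + ρ ≤ L → suc (suc (ρ + r) + 0) ≤ L + r
      rewrite-arith {ρ} {r} {L} room = begin
        suc (suc (ρ + r) + 0) ≡⟨ cong suc (+-identityʳ (suc (ρ + r))) ⟩
        2 + ρ + r             ≤⟨ +-monoˡ-≤ r room ⟩
        L + r                 ∎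
        where open ≤-Reasoning

      deduce-arith : ∀ {c d L} → 2 + d ≤ L → suc (suc (c + d) + 0) ≤ L + c
      deduce-arith {c} {d} {L} room = begin
        suc (suc (c + d) + 0) ≡⟨ cong suc (trans (+-identityʳ (suc (c + d))) (cong suc (+-comm c d))) ⟩
        2 + d + c             ≤⟨ +-monoˡ-≤ c room ⟩
        L + c                 ∎
        where open ≤-Reasoning

      collapse-arith : ∀ {a b c d} → a + b ≡ c + d → d < b → a < c
      collapse-arith {a} {b} {c} {d} eq d<b = +-cancelʳ-< b a c (begin-strict
        a + b ≡⟨ eq ⟩
        c + d <⟨ +-monoʳ-< c d<b ⟩
        c + b ∎)
        where open ≤-Reasoning

    module _ {K R} (h≤H : ∀ c → h c ≤ H) (h-desc : ∀ {c d} → c < d → d ∈ K → h d < h c)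
             (R↓ : OrientedRules K R) where

      2+2h≤D : ∀ c → 2 + 2 * h c ≤ D
      2+2h≤D c = +-monoʳ-≤ 2 (*-monoʳ-≤ 2 (h≤H c))

      C-rule-desc : ∀ {c d} → (cst c , cst d) ∈ R → h d < h c
      C-rule-desc cd∈R with R↓ cd∈R
      ... | crule c<d d∈K = h-desc c<d d∈K

      rhs-lighter : ∀ {t c} → (t , cst c) ∈ R → 2 * h c < weight t
      rhs-lighter {c = c} tc∈R with R↓ tc∈R
      ... | crule b<c c∈K         = *-monoʳ-< 2 (h-desc b<c c∈K)
      ... | drule (mk f ts _ , _) = begin-strict
        2 * h c            <⟨ m<n+m (2 * h c) {2} z<s ⟩
        2 + 2 * h c        ≤⟨ 2+2h≤D c ⟩
        D                  ≤⟨ D≤Q ⟩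
        Q                  ≤⟨ m≤m+n Q _ ⟩
        Q + isInterp f * Q ≤⟨ m≤m+n _ (weights ts) ⟩
        weight (fn f ts)   ∎
        where open ≤-Reasoning

      lhs-heavy : ∀ {s c t d} → (s , cst c) ∈ R → (t , cst d) ∈ R → EqE E s t → 2 + 2 * h d ≤ lhsPot s
      lhs-heavy {fn f ts} {d = d} _ _ _ = ≤-trans (2+2h≤D d) (≤-trans (m≤m+n D _) (m≤m+n _ (weights ts)))
      lhs-heavy {cst x} {t = t} {d} _ td∈R s≈t with t | EqE-constOf s≈t
      ... | cst .x | refl = ≤-trans (≤-reflexive (sym (*-suc 2 (h d)))) (*-monoʳ-≤ 2 (C-rule-desc td∈R))

      contractum-light : ∀ {l rσ} → InstB B l rσ → 2 + weight rσ ≤ lhsPot l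
      contractum-light inst with redex-weight (λ c → 2 * h c) (λ f → symbolWeight f * Q) B inst
      contractum-light {cst _}   _ | () , _
      contractum-light {fn g ts} _ | _ , inj₁ ρ≤args =
        ≤-trans (+-mono-≤ (m≤m+n 2 (2 * H)) ρ≤args) (+-monoˡ-≤ (weights ts) (m≤m+n D _))
      contractum-light {fn g ts} {rσ} _ | g-interp , inj₂ (z , z-uninterp , ρ≡) = begin
        2 + weight rσ                   ≡⟨ cong (2 +_) (trans ρ≡ (cong (_* Q) symbolWeight-z)) ⟩
        2 + isInterp g * Q              ≤⟨ +-monoˡ-≤ (isInterp g * Q) (m≤m+n 2 (2 * H)) ⟩
        D + isInterp g * Q              ≤⟨ m≤m+n _ (weights ts) ⟩
        D + isInterp g * Q + weights ts ∎
        where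
          open ≤-Reasoning
          symbolWeight-z : symbolWeight z ≡ isInterp g
          symbolWeight-z = trans (cong suc z-uninterp) (sym g-interp)

      potential-local : ∀ {ι P S′} → (st : Step E B ι ⟨ K , P , R ⟩ S′) →
                        1 + PotAccounting.added (change st) ≤ PotAccounting.removed (change st)
      potential-local (extend _ c _ _ _ e→e′ (mk _ _ _) _ _ _ _) =
        extend-arith (eqnWeight-ReplEq e→e′) (extension-room (h≤H c))
      potential-local (simplify _ _ _ _ tc∈R _ e→e′ _ _ _) =
        simplify-arith (eqnWeight-ReplEq e→e′) (rhs-lighter tc∈R)
      potential-local (rewrite′ _ _ _ _ inst _ _ _) =
        rewrite-arith (contractum-light inst)
      potential-local (orient s t _ _ _ _ _ _) =
        ≤-trans (s≤s (+-monoˡ-≤ (weight t) (lhsPot≤weight s))) (m≤m+n _ 0)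
      potential-local (deduce _ _ _ _ sc∈R td∈R _ s≈t _ _ _) =
        deduce-arith (lhs-heavy sc∈R td∈R s≈t)
      potential-local (delete _ _ _ _ _ _ _) = s≤s z≤n
      potential-local (compose t _ _ _ cd∈R _ _ _ _) =
        +-monoʳ-< (lhsPot t) (*-monoʳ-< 2 (C-rule-desc cd∈R))
      potential-local (collapse _ _ _ _ _ _ cd∈R _ (inside f ts i u p) _ _ _) =
        +-monoˡ-< _ (+-monoʳ-< (D + isInterp f * Q) (collapse-arith (weights-Repl ts i p) 2hd<2hc))
        where
          2hd<2hc : 2 * h _ < 2 * h _
          2hd<2hc = *-monoʳ-< 2 (C-rule-desc cd∈R)

  potential-monoʰ : ∀ H {h h′} → (∀ c → h′ c ≤ h c) →
                    ∀ S → Potential.potential H h′ S ≤ Potential.potential H h S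
  potential-monoʰ H {h} {h′} h′≤h S =
    +-mono-≤ (Pᵈ.distinctSum-mono eqnPot-mono (State.P S)) (Rᵈ.distinctSum-mono rulePot-mono (State.R S))
    where
      module Pot  = Potential H h
      module Pot′ = Potential H h′
      2h′≤2h : ∀ c → 2 * h′ c ≤ 2 * h c
      2h′≤2h c = *-monoʳ-≤ 2 (h′≤h c)
      weight-mono : ∀ t → Pot′.weight t ≤ Pot.weight t
      weight-mono = weight-monoᶜ (λ f → symbolWeight f * Pot.Q) 2h′≤2h
      eqnPot-mono : ∀ e → Pot′.eqnPot e ≤ Pot.eqnPot e
      eqnPot-mono (a , b) = s≤s (+-mono-≤ (weight-mono a) (weight-mono b))
      rulePot-mono : ∀ r → Pot′.rulePot r ≤ Pot.rulePot r
      rulePot-mono (cst c , r)   = +-mono-≤ (2h′≤2h c) (weight-mono r)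
      rulePot-mono (fn f ts , r) = +-mono-≤ (+-monoʳ-≤ (Pot.D + isInterp f * Pot.Q) args-mono) (weight-mono r)
        where
          args-mono : Pot′.weights ts ≤ Pot.weights ts
          args-mono = weights-monoᶜ (λ f → symbolWeight f * Pot.Q) 2h′≤2h ts

  Φ : ℕ → State → ℕ
  Φ H S = Potential.potential H (rank S) S

  Φ-step : ∀ {H ι S S′} → Invariant H S → Step E B ι S S′ → Φ H S′ < Φ H S
  Φ-step {H} {S = S} {S′} inv st = begin-strict
    Potential.potential H (rank S′) S′ ≤⟨ potential-monoʰ H (rank-step inv st) S′ ⟩
    Potential.potential H (rank S) S′  <⟨ Pot.PotAccounting.potential-step (change st) 1 local ⟩
    Potential.potential H (rank S) S   ∎
    where
      open ≤-Reasoning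
      module Pot = Potential H (rank S)
      local : 1 + Pot.PotAccounting.added (change st) ≤ Pot.PotAccounting.removed (change st)
      local = Pot.potential-local (rank-bounded inv) (rank-descends {S}) (oriented inv) st

  length≤potential : ∀ {P₀} (d : Derivation E B P₀) (I : State → Set) (Φ : State → ℕ) →
                     I (Derivation.st d 0) → (∀ {ι S S′} → I S → Step E B ι S S′ → I S′ × Φ S′ < Φ S) →
                     ∃ λ L → Derivation.len d ≡ just L × L ≤ Φ (Derivation.st d 0)
  length≤potential d I Φ I₀ step = bounded len refl
    where
      open Derivation d
      descent : ∀ i → (∀ j → j < i → StepIdx len j) → I (st i) × Φ (st i) + i ≤ Φ (st 0)
      descent zero    _       = I₀ , ≤-reflexive (+-identityʳ _)
      descent (suc i) defined with descent i (λ j j<i → defined j (m<n⇒m<1+n j<i))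
      ... | Iᵢ , bound with step Iᵢ (steps i (defined i (n<1+n i)))
      ...   | Iᵢ₊₁ , Φ< = Iᵢ₊₁ , (begin
        Φ (st (suc i)) + suc i   ≡⟨ +-suc (Φ (st (suc i))) i ⟩
        suc (Φ (st (suc i))) + i ≤⟨ +-monoˡ-≤ i Φ< ⟩
        Φ (st i) + i             ≤⟨ bound ⟩
        Φ (st 0)                 ∎)
        where open ≤-Reasoning
      defined-below : ∀ {x} → len ≡ x → ∀ n → (∀ j → j < n → StepIdx x j) → ∀ j → j < n → StepIdx len j
      defined-below len≡x _ defined j j<n = subst (λ x → StepIdx x j) (sym len≡x) (defined j j<n)
      bounded : ∀ x → len ≡ x → ∃ λ L → len ≡ just L × L ≤ Φ (st 0)
      bounded (just L) len≡L =
        L , len≡L , ≤-trans (m≤n+m L _) (proj₂ (descent L (defined-below len≡L L (λ _ j<L → j<L))))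
      bounded nothing  len≡∞ =
        contradiction (≤-trans (m≤n+m _ _) (proj₂ (descent (suc (Φ (st 0))) all-defined))) 1+n≰n
        where
          all-defined : ∀ j → j < suc (Φ (st 0)) → StepIdx len j
          all-defined = defined-below len≡∞ _ (λ _ _ → tt)

  distinctSum≤totalSize : ∀ {w X} → (∀ e → w e ≤ X * eqSize e) → ∀ P → Pᵈ.distinctSum w P ≤ X * totalSize P
  distinctSum≤totalSize {w} {X} w≤ P = ≤-trans (Pᵈ.distinctSum≤sum w P) (sum≤ P)
    where
      sum≤ : ∀ P → sum (map w P) ≤ X * totalSize P
      sum≤ []      = z≤n
      sum≤ (e ∷ P) =
        ≤-trans (+-mono-≤ (w≤ e) (sum≤ P)) (≤-reflexive (sym (*-distribˡ-+ X (eqSize e) (totalSize P))))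

  symbolCount-initial : ∀ P → symbolCount ⟨ [] , P , [] ⟩ ≤ 2 * totalSize P
  symbolCount-initial P = ≤-trans (≤-reflexive (+-identityʳ _)) (distinctSum≤totalSize {X = 2} eqnSymbols≤ P)
    where
      weight≤ : ∀ t → Symbols.weight t ≤ 2 * size t
      weight≤ = Symbols.weight≤size (λ _ → z≤n) (λ f → s≤s (interpCount≤1 (interpreted B) f))
      eqnSymbols≤ : ∀ e → Symbols.eqnWeight e ≤ 2 * eqSize e
      eqnSymbols≤ (a , b) =
        ≤-trans (+-mono-≤ (weight≤ a) (weight≤ b)) (≤-reflexive (sym (*-distribˡ-+ 2 (size a) (size b))))

  potential-initial : ∀ H {h} → (∀ c → h c ≤ H) → ∀ P →
                      Potential.potential H h ⟨ [] , P , [] ⟩ ≤ (1 + 2 * Potential.Q H h) * totalSize P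
  potential-initial H {h} h≤H P =
    ≤-trans (≤-reflexive (+-identityʳ _)) (distinctSum≤totalSize {X = 1 + 2 * Q} eqnPot≤ P)
    where
      open Potential H h
      2h≤2Q : ∀ c → 2 * h c ≤ 2 * Q
      2h≤2Q c = *-monoʳ-≤ 2 (≤-trans (h≤H c) (≤-trans (m≤n*m H 6) (m≤n+m _ 3)))
      weight≤ : ∀ t → weight t ≤ 2 * Q * size t
      weight≤ = weight≤size 2h≤2Q (λ f → *-monoˡ-≤ Q (s≤s (interpCount≤1 (interpreted B) f)))
      size≥1 : ∀ t → 1 ≤ size t
      size≥1 (cst _)  = s≤s z≤n
      size≥1 (fn _ _) = s≤s z≤n
      eqnPot≤ : ∀ e → eqnPot e ≤ (1 + 2 * Q) * eqSize e
      eqnPot≤ (a , b) = +-mono-≤ (≤-trans (size≥1 a) (m≤m+n (size a) (size b)))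
        (≤-trans (+-mono-≤ (weight≤ a) (weight≤ b)) (≤-reflexive (sym (*-distribˡ-+ (2 * Q) (size a) (size b)))))

  quadratic-bound : ∀ {H n} → H ≤ 2 * n → (1 + 2 * (3 + 6 * H)) * n ≤ 31 * (n * n) + 31
  quadratic-bound {H} {n} H≤2n = begin
    (1 + 2 * (3 + 6 * H)) * n       ≤⟨ *-monoˡ-≤ n (+-monoʳ-≤ 1 (*-monoʳ-≤ 2 (+-monoʳ-≤ 3 6H≤12n))) ⟩
    (1 + 2 * (3 + 6 * (2 * n))) * n ≡⟨ expand n ⟩
    7 * n + 24 * (n * n)            ≤⟨ +-monoˡ-≤ (24 * (n * n)) (*-monoʳ-≤ 7 (n≤n*n+1 n)) ⟩
    7 * (n * n + 1) + 24 * (n * n)  ≡⟨ collect n ⟩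
    31 * (n * n) + 7                ≤⟨ +-monoʳ-≤ (31 * (n * n)) (m≤m+n 7 24) ⟩
    31 * (n * n) + 31               ∎
    where
      open ≤-Reasoning
      6H≤12n : 6 * H ≤ 6 * (2 * n)
      6H≤12n = *-monoʳ-≤ 6 H≤2n
      n≤n*n+1 : ∀ n → n ≤ n * n + 1
      n≤n*n+1 zero    = z≤n
      n≤n*n+1 (suc k) = ≤-trans (m≤m*n (suc k) (suc k)) (m≤m+n _ 1)
      expand : ∀ n → (1 + 2 * (3 + 6 * (2 * n))) * n ≡ 7 * n + 24 * (n * n)
      expand = solve-∀
      collect : ∀ n → 7 * (n * n + 1) + 24 * (n * n) ≡ 31 * (n * n) + 7
      collect = solve-∀

  derivation-length : ∀ {P₀} (d : Derivation E B P₀) →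
                      ∃ λ L → Derivation.len d ≡ just L × L ≤ 31 * (totalSize P₀ * totalSize P₀) + 31
  derivation-length {P₀} d =
    map₂ (map₂ (λ L≤Φ₀ → ≤-trans L≤Φ₀ Φ₀-bound))
         (length≤potential d (Invariant H) (Φ H) (subst (Invariant H) (sym st₀≡S₀) (invariant-initial P₀))
                           (λ inv st → invariant-step inv st , Φ-step inv st))
    where
      open Derivation d using (st) renaming (start to st₀≡S₀)
      H : ℕ
      H = symbolCount ⟨ [] , P₀ , [] ⟩
      rank₀≤H : ∀ c → rank ⟨ [] , P₀ , [] ⟩ c ≤ H
      rank₀≤H = rank-bounded (invariant-initial P₀)
      Φ₀-bound : Φ H (st 0) ≤ 31 * (totalSize P₀ * totalSize P₀) + 31
      Φ₀-bound = begin
        Φ H (st 0)                              ≡⟨ cong (Φ H) st₀≡S₀ ⟩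
        Φ H ⟨ [] , P₀ , [] ⟩                    ≤⟨ potential-initial H rank₀≤H P₀ ⟩
        (1 + 2 * (3 + 6 * H)) * totalSize P₀    ≤⟨ quadratic-bound {H} {totalSize P₀} (symbolCount-initial P₀) ⟩
        31 * (totalSize P₀ * totalSize P₀) + 31 ∎
        where open ≤-Reasoning

lemma2 : (m : ℕ) (ar : Fin m → ℕ) (E : List (Rewriting.PermEq ar))
         (B : Rewriting.BChoice ar) → Rewriting.CommCond ar E B →
         ∃ λ (C : ℕ) → (P₀ : List (Rewriting.Eqn ar)) →
         All (λ e → Rewriting.Pure ar (proj₁ e) × Rewriting.Pure ar (proj₂ e)) P₀ →
         AllPairs (λ e e′ → ¬ Rewriting.SameEq ar e e′) P₀ →
         (d : Rewriting.Derivation ar E B P₀) → Rewriting.FairMu ar d →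
         ∃ λ (L : ℕ) → Rewriting.Derivation.len d ≡ just L ×
           L ≤ C * (Rewriting.totalSize ar P₀ * Rewriting.totalSize ar P₀) + C
lemma2 m ar E B _ = 31 , λ P₀ _ _ d _ → Termination.derivation-length ar E B d
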